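{- There is a constant $c>0$ such that the following holds. Let $m\ge 1$ and let $H^1,H^2,\dots,H^k$ be finite undirected simple graphs such that for every $i$: $V(H^i)=V^i_\ell\,\dot\cup\, V^i_u$ with $|V^i_\ell|=|V^i_u|\le m$; the set $V^i_\ell$ is independent in $H^i$; and for $i<k$: $V^{i+1}_\ell\supseteq V^i_\ell$, $V^{i+1}_u\supseteq V^i_u$, $\triangle(H^i)\subseteq H^{i+1}$ (as subgraph), and $H^i\neq H^{i+1}$. Then $k\le c\,m$.
   Context: For an undirected simple graph $H$ whose vertex set is partitioned into "upper" vertices $V_u$ and "lower" vertices $V_\ell$, the triangle completion $\triangle(H)$ is the graph on the same vertex set (with the same partition) obtained by applying the following rules once, simultaneously, with respect to the edges of $H$: add an edge between every two distinct upper vertices that have a common neighbor (in $V_\ell$ or in $V_u$); add an edge between every upper vertex and every lower vertex that have a common neighbor in $V_u$. All edges of $H$ are kept. $\triangle(H^i)\subseteq H^{i+1}$ means $V(\triangle(H^i))\subseteq V(H^{i+1})$ and $E(\triangle(H^i))\subseteq E(H^{i+1})$. -}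

module Defs where

open import Data.Nat using (ℕ; suc; _≤_; _<_; _*_)
open import Data.Fin using (Fin)
open import Data.Fin.Subset using (Subset; _∈_; _⊆_; ∣_∣)
open import Data.Bool using (Bool; true; false)
open import Data.Product using (_×_; ∃-syntax; Σ-syntax)
open import Data.Sum using (_⊎_)
open import Relation.Nullary using (¬_)
open import Relation.Binary.PropositionalEquality using (_≡_; _≢_)

-- A finite simple graph whose vertices lie in the ambient finite set Fin N,
-- with vertex set partitioned into lower vertices and upper vertices.
record PGraph (N : ℕ) : Set where
  field
    lower : Subset N
    upper : Subset N
    edge  : Fin N → Fin N → Bool
    disjoint    : ∀ v → ¬ (v ∈ lower × v ∈ upper)
    edge-sym    : ∀ x y → edge x y ≡ edge y x
    edge-irrefl : ∀ x → edge x x ≡ false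
    edge-vert   : ∀ x y → edge x y ≡ true → (x ∈ lower ⊎ x ∈ upper)

open PGraph public

Adj : ∀ {N} → PGraph N → Fin N → Fin N → Set
Adj H x y = edge H x y ≡ true

InV : ∀ {N} → PGraph N → Fin N → Set
InV H v = v ∈ lower H ⊎ v ∈ upper H

LowerIndependent : ∀ {N} → PGraph N → Set
LowerIndependent H = ∀ x y → x ∈ lower H → y ∈ lower H → edge H x y ≡ false

TriEdge : ∀ {N} → PGraph N → Fin N → Fin N → Set
TriEdge H x y =
    Adj H x y
  ⊎ ((x ∈ upper H × y ∈ upper H × x ≢ y × ∃[ z ] (Adj H x z × Adj H z y))
  ⊎ ((x ∈ upper H × y ∈ lower H × ∃[ z ] (z ∈ upper H × Adj H x z × Adj H z y))
  ⊎  (x ∈ lower H × y ∈ upper H × ∃[ z ] (z ∈ upper H × Adj H x z × Adj H z y))))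

-- △(H) ⊆ H' as subgraph (vertex sets and edge sets); V(△(H)) = V(H)
TriSubgraph : ∀ {N} → PGraph N → PGraph N → Set
TriSubgraph H H' =
  (∀ v → InV H v → InV H' v) × (∀ x y → TriEdge H x y → Adj H' x y)

SameGraph : ∀ {N} → PGraph N → PGraph N → Set
SameGraph H H' =
  (∀ v → (v ∈ lower H → v ∈ lower H') × (v ∈ lower H' → v ∈ lower H))
  × (∀ v → (v ∈ upper H → v ∈ upper H') × (v ∈ upper H' → v ∈ upper H))
  × (∀ x y → edge H x y ≡ edge H' x y)

-- Give each connected component of a graph on Fin N the weight 2 + its diameter, and let Φ be the
-- total; vertices outside V(H) are isolated, so 2N − 2|V(H)| ≤ Φ(H) ≤ 2N.  Adding edges never
-- increases Φ, and merging two components of diameters d, d′ into one of diameter ≤ d + d′ + 1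
-- decreases it.  Since V_ℓ is independent, triangle completion shortens every walk of length ≥ 3.
-- So if Hⁱ⁺¹ merges no components of Hⁱ, Φ still drops unless all components of Hⁱ have diameter
-- ≤ 2; and if then Hⁱ⁺² merges nothing and adds no vertex, every edge of Hⁱ⁺² joins vertices at
-- distance ≤ 2 in Hⁱ, hence lies in △(Hⁱ) ⊆ Hⁱ⁺¹, contradicting Hⁱ⁺¹ ≠ Hⁱ⁺².  Thus Φ − |V| drops
-- at least every second step, and |V| ≤ 2m gives k ≤ 14m.

module Submission where

open import Defs
open import Level using (Level)
open import Data.Bool using (Bool; true; false; if_then_else_)
import Data.Bool.Properties as Bool
open import Data.Fin using (Fin; zero; suc)
import Data.Fin as F
import Data.Fin.Properties as Fin
open import Data.Fin.Subset using (Subset; _∈_; _⊆_; ∣_∣; _∪_; ∁; inside; outside)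
open import Data.Fin.Subset.Properties
  using (_∈?_; x∈p∪q⁻; x∈p∪q⁺; p⊆q⇒∣p∣≤∣q∣; p⊂q⇒∣p∣<∣q∣; ∣∁p∣≡n∸∣p∣; ∣p∣≤n; x∈∁p⇒x∉p)
open import Data.List using ([]; _∷_; cartesianProduct; allFin)
import Data.List.Membership.Propositional as List
open import Data.List.Membership.Propositional.Properties using (∈-cartesianProduct⁺; ∈-allFin)
import Data.List.Relation.Unary.Any as Any
open import Data.Nat using (ℕ; zero; suc; _+_; _*_; _≤_; _<_; z≤n; s≤s; _≤′_; ≤′-refl; ≤′-step; _≤?_)
open import Data.Nat.Properties
open import Algebra.Properties.Monoid.Sum +-0-monoid using (sum; sum-syntax)
open import Data.Nat.Tactic.RingSolver using (solve-∀)
open import Data.Product using (∃-syntax; _×_; _,_; proj₁; proj₂)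
open import Data.Sum using (_⊎_; inj₁; inj₂; [_,_])
open import Data.Vec using (_∷_; []; here; there)
open import Function using (_∘_; mk⇔)
open import Relation.Binary.PropositionalEquality using (_≡_; _≢_; refl; sym; trans; cong; cong₂; subst; subst₂)
open import Relation.Nullary using (¬_; Dec; yes; no; does; contradiction)
open import Relation.Nullary.Decidable
  using (_×-dec_; _⊎-dec_; _→-dec_; ¬?; decidable-stable; dec-true; dec-false; does-⇔)
open import Relation.Unary using (Pred; Decidable)

private
  variable
    ℓ ℓ₁ ℓ₂ : Level
    A : Set ℓ₁
    B : Set ℓ₂

sum-mono-≤ : ∀ {n} {f g : Fin n → ℕ} → (∀ i → f i ≤ g i) → sum f ≤ sum g
sum-mono-≤ {zero}  f≤g = z≤n
sum-mono-≤ {suc n} f≤g = +-mono-≤ (f≤g zero) (sum-mono-≤ (f≤g ∘ suc))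

sum-mono-< : ∀ {n} {f g : Fin n → ℕ} → (∀ i → f i ≤ g i) → ∀ j → f j < g j → sum f < sum g
sum-mono-< f≤g zero    fj<gj = +-mono-<-≤ fj<gj (sum-mono-≤ (f≤g ∘ suc))
sum-mono-< f≤g (suc j) fj<gj = +-mono-≤-< (f≤g zero) (sum-mono-< (f≤g ∘ suc) j fj<gj)

sum-≤-* : ∀ {n} {f : Fin n → ℕ} c → (∀ i → f i ≤ c) → sum f ≤ n * c
sum-≤-* {zero}  c f≤c = z≤n
sum-≤-* {suc n} c f≤c = +-mono-≤ (f≤c zero) (sum-≤-* c (f≤c ∘ suc))

∣p∣*c≤sum : ∀ {n} (p : Subset n) {f : Fin n → ℕ} c → (∀ i → i ∈ p → c ≤ f i) → ∣ p ∣ * c ≤ sum f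
∣p∣*c≤sum []            c c≤f = z≤n
∣p∣*c≤sum (inside  ∷ p) c c≤f = +-mono-≤ (c≤f zero here) (∣p∣*c≤sum p c (λ i → c≤f (suc i) ∘ there))
∣p∣*c≤sum (outside ∷ p) {f} c c≤f =
  ≤-trans (∣p∣*c≤sum p c (λ i → c≤f (suc i) ∘ there)) (m≤n+m _ (f zero))

sum-exchange : ∀ {n} {f g : Fin n → ℕ} j → (∀ i → i ≢ j → f i ≤ g i) → sum f + g j ≤ sum g + f j
sum-exchange {suc n} {f} {g} zero f≤g = begin
  f zero + sum (f ∘ suc) + g zero   ≡⟨ rearrange (f zero) (sum (f ∘ suc)) (g zero) ⟩
  g zero + (sum (f ∘ suc) + f zero) ≤⟨ +-monoʳ-≤ (g zero) (+-monoˡ-≤ (f zero) (sum-mono-≤ λ i → f≤g (suc i) λ ())) ⟩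
  g zero + (sum (g ∘ suc) + f zero) ≡⟨ +-assoc (g zero) _ _ ⟨
  g zero + sum (g ∘ suc) + f zero   ∎
  where
  open ≤-Reasoning
  rearrange : ∀ a b c → a + b + c ≡ c + (b + a)
  rearrange = solve-∀
sum-exchange {suc n} {f} {g} (suc j) f≤g = begin
  f zero + sum (f ∘ suc) + g (suc j)   ≡⟨ +-assoc (f zero) _ _ ⟩
  f zero + (sum (f ∘ suc) + g (suc j)) ≤⟨ +-mono-≤ (f≤g zero λ ()) (sum-exchange j λ i → f≤g (suc i) ∘ (_∘ Fin.suc-injective)) ⟩
  g zero + (sum (g ∘ suc) + f (suc j)) ≡⟨ +-assoc (g zero) _ _ ⟨
  g zero + sum (g ∘ suc) + f (suc j)   ∎
  where
  open ≤-Reasoning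

private
  sum-head-exchange : ∀ {n} {f g : Fin (suc n) → ℕ} k → (∀ i → i ≢ k → f (suc i) ≤ g (suc i)) →
                      f zero + f (suc k) < g zero + g (suc k) → sum f < sum g
  sum-head-exchange {f = f} {g} k f≤g head< = +-cancelʳ-< (g′ k + f′ k) (sum f) (sum g) (begin-strict
    f zero + sum f′ + (g′ k + f′ k)   ≡⟨ swap (f zero) (sum f′) (g′ k) (f′ k) ⟩
    f zero + f′ k + (sum f′ + g′ k)   <⟨ +-mono-<-≤ head< (sum-exchange k f≤g) ⟩
    g zero + g′ k + (sum g′ + f′ k)   ≡⟨ swap′ (g zero) (g′ k) (sum g′) (f′ k) ⟩
    g zero + sum g′ + (g′ k + f′ k)   ∎)
    where
    open ≤-Reasoning
    f′ g′ : _ → ℕ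
    f′ = f ∘ suc
    g′ = g ∘ suc
    swap : ∀ a b c d → a + b + (c + d) ≡ a + d + (b + c)
    swap = solve-∀
    swap′ : ∀ a b c d → a + b + (c + d) ≡ a + c + (b + d)
    swap′ = solve-∀

sum-mono-<₂ : ∀ {n} {f g : Fin n → ℕ} {j k} → j ≢ k → (∀ i → i ≢ j → i ≢ k → f i ≤ g i) →
              f j + f k < g j + g k → sum f < sum g
sum-mono-<₂ {j = zero}  {zero}  j≢k f≤g sum< = contradiction refl j≢k
sum-mono-<₂ {f = f} {g} {zero} {suc k} j≢k f≤g sum< =
  sum-head-exchange {f = f} {g} k (λ i i≢k → f≤g (suc i) (λ ()) (i≢k ∘ Fin.suc-injective)) sum<
sum-mono-<₂ {f = f} {g} {suc j} {zero} j≢k f≤g sum< =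
  sum-head-exchange {f = f} {g} j (λ i i≢j → f≤g (suc i) (i≢j ∘ Fin.suc-injective) (λ ()))
    (subst₂ _<_ (+-comm (f (suc j)) (f zero)) (+-comm (g (suc j)) (g zero)) sum<)
sum-mono-<₂ {j = suc j} {suc k} j≢k f≤g sum< =
  +-mono-≤-< (f≤g zero (λ ()) (λ ()))
    (sum-mono-<₂ (j≢k ∘ cong suc) (λ i i≢j i≢k → f≤g (suc i) (i≢j ∘ Fin.suc-injective) (i≢k ∘ Fin.suc-injective)) sum<)

𝟙 : Dec A → ℕ
𝟙 (yes _) = 1
𝟙 (no  _) = 0

𝟙≤1 : (a? : Dec A) → 𝟙 a? ≤ 1
𝟙≤1 (yes _) = s≤s z≤n
𝟙≤1 (no  _) = z≤n

𝟙-mono : (a? : Dec A) (b? : Dec B) → (A → B) → 𝟙 a? ≤ 𝟙 b?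
𝟙-mono (yes _) (yes _) _   = ≤-refl
𝟙-mono (yes a) (no ¬b) a→b = contradiction (a→b a) ¬b
𝟙-mono (no _)  _       _   = z≤n

𝟙-< : (a? : Dec A) (b? : Dec B) → ¬ A → B → 𝟙 a? < 𝟙 b?
𝟙-< (yes a) _      ¬a _ = contradiction a ¬a
𝟙-< (no _) (yes _) _  _ = s≤s z≤n
𝟙-< (no _) (no ¬b) _  b = contradiction b ¬b

module _ {n : ℕ} (P : ℕ → Pred (Fin n) ℓ) (P? : ∀ d → Decidable (P d))
         (P-mono : ∀ d {i} → P d i → P (suc d) i) where

  private
    Stalls : ℕ → Set ℓ
    Stalls d = ∀ i → P (suc d) i → P d i

    count : ℕ → ℕ
    count d = ∑[ i < n ] 𝟙 (P? d i)

    stalls-or-grows : ∀ d → (∃[ e ] (e < d × Stalls e)) ⊎ d ≤ count d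
    stalls-or-grows zero = inj₂ z≤n
    stalls-or-grows (suc d) with stalls-or-grows d
    ... | inj₁ (e , e<d , stalls) = inj₁ (e , m<n⇒m<1+n e<d , stalls)
    ... | inj₂ d≤count with Fin.any? (λ i → P? (suc d) i ×-dec ¬? (P? d i))
    ...   | yes (i , new , ¬old) = inj₂ (≤-<-trans d≤count
            (sum-mono-< (λ j → 𝟙-mono (P? d j) (P? (suc d) j) (P-mono d)) i (𝟙-< (P? d i) (P? (suc d) i) ¬old new)))
    ...   | no ¬new = inj₁ (d , n<1+n d , λ i new → decidable-stable (P? d i) (λ ¬old → ¬new (i , new , ¬old)))

  chain-stalls : ∃[ d ] (d ≤ n × ∀ i → P (suc d) i → P d i)
  chain-stalls with stalls-or-grows (suc n)
  ... | inj₁ (d , d<1+n , stalls) = d , ≤-pred d<1+n , stalls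
  ... | inj₂ 1+n≤count = contradiction count≤n (<⇒≱ 1+n≤count)
    where
    count≤n : count (suc n) ≤ n
    count≤n = ≤-trans (sum-≤-* 1 λ i → 𝟙≤1 (P? (suc n) i)) (≤-reflexive (*-identityʳ n))

-- The first d ≤ n with P d, or n if there is none.
least : {P : Pred ℕ ℓ} → Decidable P → ℕ → ℕ
least P? zero = 0
least P? (suc n) with P? 0
... | yes _ = 0
... | no  _ = suc (least (P? ∘ suc) n)

least-sound : {P : Pred ℕ ℓ} (P? : Decidable P) → ∀ n → P n → P (least P? n)
least-sound P? zero    Pn = Pn
least-sound P? (suc n) Pn with P? 0
... | yes P0 = P0
... | no  _  = least-sound (P? ∘ suc) n Pn

least-minimal : {P : Pred ℕ ℓ} (P? : Decidable P) → ∀ n {d} → P d → least P? n ≤ d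
least-minimal P? zero    Pd = z≤n
least-minimal P? (suc n) {d} Pd with P? 0
... | yes _ = z≤n
least-minimal P? (suc n) {zero}  Pd | no ¬P0 = contradiction Pd ¬P0
least-minimal P? (suc n) {suc d} Pd | no _   = s≤s (least-minimal (P? ∘ suc) n Pd)

minimum : ∀ {n} {P : Pred (Fin n) ℓ} → Decidable P → ∀ {i} → P i → ∃[ r ] (P r × ∀ {j} → P j → r F.≤ j)
minimum {n = suc n} P? {i} Pi with P? zero
... | yes P0 = zero , P0 , λ _ → z≤n
minimum {n = suc n} P? {zero}  Pi | no ¬P0 = contradiction Pi ¬P0
minimum {n = suc n} {P = P} P? {suc i} Pi | no ¬P0 with minimum (P? ∘ suc) Pi
... | r , Pr , r-min = suc r , Pr , suc-r-min
  where
  suc-r-min : ∀ {j} → P j → suc r F.≤ j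
  suc-r-min {zero}  P0 = contradiction P0 ¬P0
  suc-r-min {suc j} Pj = s≤s (r-min Pj)

Graph : ℕ → Set
Graph N = Fin N → Fin N → Bool

module _ {N : ℕ} where

  _⊑_ : Graph N → Graph N → Set
  G ⊑ G′ = ∀ x y → G x y ≡ true → G′ x y ≡ true

  IsSymmetric : Graph N → Set
  IsSymmetric G = ∀ x y → G x y ≡ G y x

  Reach : Graph N → ℕ → Fin N → Fin N → Set
  Reach G zero    x y = x ≡ y
  Reach G (suc d) x y = Reach G d x y ⊎ ∃[ z ] (Reach G d x z × G z y ≡ true)

  reach? : ∀ G d x y → Dec (Reach G d x y)
  reach? G zero    x y = x F.≟ y
  reach? G (suc d) x y = reach? G d x y ⊎-dec Fin.any? (λ z → reach? G d x z ×-dec (G z y Bool.≟ true))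

  reach-≤ : ∀ {G d e x y} → d ≤ e → Reach G d x y → Reach G e x y
  reach-≤ {G} {d} {x = x} {y} d≤e r = go (≤⇒≤′ d≤e)
    where
    go : ∀ {e} → d ≤′ e → Reach G e x y
    go ≤′-refl        = r
    go (≤′-step d≤′e) = inj₁ (go d≤′e)

  reach-edge : ∀ {G x y} → G x y ≡ true → Reach G 1 x y
  reach-edge {x = x} e = inj₂ (x , refl , e)

  reach-+ : ∀ {G} d e {x y z} → Reach G d x y → Reach G e y z → Reach G (d + e) x z
  reach-+ {G} d zero {x} r refl = subst (λ t → Reach G t x _) (sym (+-identityʳ d)) r
  reach-+ {G} d (suc e) {x} {z = z} r r′ = subst (λ t → Reach G t x z) (sym (+-suc d e)) (last r′)
    where
    last : Reach G (suc e) _ z → Reach G (suc (d + e)) x z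
    last (inj₁ r′)            = inj₁ (reach-+ d e r r′)
    last (inj₂ (w , r′ , wz)) = inj₂ (w , reach-+ d e r r′ , wz)

  reach-sym : ∀ {G} → IsSymmetric G → ∀ d {x y} → Reach G d x y → Reach G d y x
  reach-sym sym-G zero    refl     = refl
  reach-sym sym-G (suc d) (inj₁ r) = inj₁ (reach-sym sym-G d r)
  reach-sym {G} sym-G (suc d) {y = y} (inj₂ (z , r , zy)) =
    reach-+ {G} 1 d (reach-edge {G} (trans (sym-G y z) zy)) (reach-sym sym-G d r)

  reach-⊑ : ∀ {G G′} → G ⊑ G′ → ∀ d {x y} → Reach G d x y → Reach G′ d x y
  reach-⊑ G⊑G′ zero    r                    = r
  reach-⊑ G⊑G′ (suc d) (inj₁ r)             = inj₁ (reach-⊑ G⊑G′ d r)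
  reach-⊑ G⊑G′ (suc d) (inj₂ (z , r , zy)) = inj₂ (z , reach-⊑ G⊑G′ d r , G⊑G′ z _ zy)

  reach-isolated : ∀ {G x} → (∀ z → G x z ≡ false) → ∀ d {y} → Reach G d x y → y ≡ x
  reach-isolated isolated zero    refl     = refl
  reach-isolated isolated (suc d) (inj₁ r) = reach-isolated isolated d r
  reach-isolated isolated (suc d) {y} (inj₂ (z , r , zy)) with reach-isolated isolated d r
  ... | refl = contradiction (trans (sym zy) (isolated y)) λ ()

  -- Within N steps the balls around x stop growing, since each strict growth adds a vertex.
  reach-saturates : ∀ {G} d {x y} → Reach G d x y → Reach G N x y
  reach-saturates {G} d {x} r with chain-stalls (λ d → Reach G d x) (λ d → reach? G d x) (λ d → inj₁)
  ... | s , s≤N , stalls = reach-≤ s≤N (stalled d r)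
    where
    stalled : ∀ d {y} → Reach G d x y → Reach G s x y
    stalled zero    refl                = reach-≤ z≤n refl
    stalled (suc d) (inj₁ r)            = stalled d r
    stalled (suc d) (inj₂ (z , r , zy)) = stalls _ (inj₂ (z , stalled d r , zy))

  Connected : Graph N → Fin N → Fin N → Set
  Connected G = Reach G N

  connected? : ∀ G x y → Dec (Connected G x y)
  connected? G = reach? G N

  connected-refl : ∀ {G} x → Connected G x x
  connected-refl x = reach-≤ z≤n refl

  connected-sym : ∀ {G} → IsSymmetric G → ∀ {x y} → Connected G x y → Connected G y x
  connected-sym sym-G = reach-sym sym-G N

  connected-trans : ∀ {G x y z} → Connected G x y → Connected G y z → Connected G x z
  connected-trans r r′ = reach-saturates (N + N) (reach-+ N N r r′)

  connected-edge : ∀ {G x y} → G x y ≡ true → Connected G x y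
  connected-edge {G} e = reach-saturates 1 (reach-edge {G} e)

  far-or-close : ∀ G → (∃[ x ] ∃[ y ] (Connected G x y × ¬ Reach G 2 x y)) ⊎
                       (∀ x y → Connected G x y → Reach G 2 x y)
  far-or-close G with Fin.any? (λ x → Fin.any? (λ y → connected? G x y ×-dec ¬? (reach? G 2 x y)))
  ... | yes far  = inj₁ far
  ... | no ¬far = inj₂ λ x y xy → decidable-stable (reach? G 2 x y) λ ¬r → ¬far (x , y , xy , ¬r)

-- The component potential

module _ {N : ℕ} where

  DiameterAtMost : Graph N → Fin N → ℕ → Set
  DiameterAtMost G v d = ∀ x y → Connected G v x → Connected G v y → Reach G d x y

  diameterAtMost? : ∀ G v d → Dec (DiameterAtMost G v d)
  diameterAtMost? G v d =
    Fin.all? λ x → Fin.all? λ y → connected? G v x →-dec (connected? G v y →-dec reach? G d x y)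

  diameter : Graph N → Fin N → ℕ
  diameter G v = least (diameterAtMost? G v) N

  IsLeader : Graph N → Fin N → Set
  IsLeader G v = ∀ u → Connected G u v → v F.≤ u

  isLeader? : ∀ G v → Dec (IsLeader G v)
  isLeader? G v = Fin.all? λ u → connected? G u v →-dec (v F.≤? u)

  -- Every component contributes 2 + its diameter, booked at its least vertex.
  weight : Graph N → Fin N → ℕ
  weight G v = if does (isLeader? G v) then 2 + diameter G v else 0

  potential : Graph N → ℕ
  potential G = ∑[ v < N ] weight G v

  diameter-minimal : ∀ G v {d} → DiameterAtMost G v d → diameter G v ≤ d
  diameter-minimal G v = least-minimal (diameterAtMost? G v) N

  diameter-sound : ∀ {G} → IsSymmetric G → ∀ v → DiameterAtMost G v (diameter G v)
  diameter-sound {G} sym-G v = least-sound (diameterAtMost? G v) N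
    λ x y vx vy → connected-trans (connected-sym sym-G vx) vy

  leader-of : ∀ {G} → IsSymmetric G → ∀ x → ∃[ r ] (Connected G r x × IsLeader G r)
  leader-of {G} sym-G x with minimum (λ u → connected? G u x) (connected-refl x)
  ... | r , rx , r-min = r , rx , λ u ur → r-min (connected-trans ur rx)

  leader-unique : ∀ {G} → IsSymmetric G → ∀ {u v} → IsLeader G u → IsLeader G v → Connected G u v → u ≡ v
  leader-unique sym-G {u} {v} leader-u leader-v uv =
    Fin.≤-antisym (leader-u v (connected-sym sym-G uv)) (leader-v u uv)

  weight-leader : ∀ G {v} → IsLeader G v → weight G v ≡ 2 + diameter G v
  weight-leader G {v} leader rewrite dec-true (isLeader? G v) leader = refl

  weight-nonleader : ∀ G {v} → ¬ IsLeader G v → weight G v ≡ 0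
  weight-nonleader G {v} ¬leader rewrite dec-false (isLeader? G v) ¬leader = refl

  weight-≤ : ∀ G v → weight G v ≤ 2 + diameter G v
  weight-≤ G v with does (isLeader? G v)
  ... | true  = ≤-refl
  ... | false = z≤n

  Unmerged : Graph N → Graph N → Set
  Unmerged G G′ = ∀ {x y} → Connected G′ x y → Connected G x y

  module _ {G G′ : Graph N} (sym-G : IsSymmetric G) (G⊑G′ : G ⊑ G′) where

    weight-⊑ : ∀ v → (∀ {x} → Connected G′ v x → Connected G v x) → weight G′ v ≤ weight G v
    weight-⊑ v unmerged with isLeader? G′ v
    ... | no ¬leader′ = ≤-trans (≤-reflexive (weight-nonleader G′ ¬leader′)) z≤n
    ... | yes leader′ = begin
      weight G′ v         ≤⟨ weight-≤ G′ v ⟩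
      2 + diameter G′ v   ≤⟨ +-monoʳ-≤ 2 (diameter-minimal G′ v shrunk) ⟩
      2 + diameter G v    ≡⟨ weight-leader G leader ⟨
      weight G v          ∎
      where
      open ≤-Reasoning
      leader : IsLeader G v
      leader u uv = leader′ u (reach-⊑ G⊑G′ N uv)
      shrunk : DiameterAtMost G′ v (diameter G v)
      shrunk x y vx vy = reach-⊑ G⊑G′ _ (diameter-sound sym-G v x y (unmerged vx) (unmerged vy))

    module _ (unmerged : Unmerged G G′) where

      potential-⊑ : potential G′ ≤ potential G
      potential-⊑ = sum-mono-≤ λ v → weight-⊑ v unmerged

      potential-shortcut : (∀ d {x y} → Reach G (3 + d) x y → Reach G′ (2 + d) x y) →
                           ∀ {x y} → Connected G x y → ¬ Reach G 2 x y → potential G′ < potential G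
      potential-shortcut shortcut {x} {y} xy far with leader-of sym-G x
      ... | r , rx , leader = sum-mono-< (λ v → weight-⊑ v unmerged) r (begin-strict
        weight G′ r          ≤⟨ weight-≤ G′ r ⟩
        2 + diameter G′ r    ≤⟨ +-monoʳ-≤ 2 (diameter-minimal G′ r shrunk) ⟩
        2 + (2 + e)          <⟨ n<1+n _ ⟩
        2 + (3 + e)          ≡⟨ cong (2 +_) diam≡3+e ⟨
        2 + diameter G r     ≡⟨ weight-leader G leader ⟨
        weight G r           ∎)
        where
        open ≤-Reasoning
        3≤diam : 3 ≤ diameter G r
        3≤diam = ≰⇒> λ diam≤2 → far (reach-≤ diam≤2 (diameter-sound sym-G r x y rx (connected-trans rx xy)))
        e : ℕ
        e = proj₁ (m≤n⇒∃[o]m+o≡n 3≤diam)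
        diam≡3+e : diameter G r ≡ 3 + e
        diam≡3+e = sym (proj₂ (m≤n⇒∃[o]m+o≡n 3≤diam))
        shrunk : DiameterAtMost G′ r (2 + e)
        shrunk a b ra rb = shortcut e (subst (λ d → Reach G d a b) diam≡3+e
          (diameter-sound sym-G r a b (unmerged ra) (unmerged rb)))

-- Adding edges

private
  from-does : ∀ {a} {A : Set a} (a? : Dec A) → does a? ≡ true → A
  from-does (yes a) _ = a

module _ {N : ℕ} (G : Graph N) (a b : Fin N) where

  Linked : Fin N → Fin N → Set
  Linked x y = G x y ≡ true ⊎ (x ≡ a × y ≡ b) ⊎ (x ≡ b × y ≡ a)

  linked? : ∀ x y → Dec (Linked x y)
  linked? x y = (G x y Bool.≟ true) ⊎-dec ((x F.≟ a ×-dec y F.≟ b) ⊎-dec (x F.≟ b ×-dec y F.≟ a))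

  addEdge : Graph N
  addEdge x y = does (linked? x y)

  addEdge-linked : ∀ {x y} → addEdge x y ≡ true → Linked x y
  addEdge-linked {x} {y} = from-does (linked? x y)

  ⊑-addEdge : G ⊑ addEdge
  ⊑-addEdge x y xy = dec-true (linked? x y) (inj₁ xy)

  addEdge-new : addEdge a b ≡ true
  addEdge-new = dec-true (linked? a b) (inj₂ (inj₁ (refl , refl)))

  addEdge-sym : IsSymmetric G → IsSymmetric addEdge
  addEdge-sym sym-G x y = does-⇔ (mk⇔ flip-linked flip-linked) (linked? x y) (linked? y x)
    where
    flip-linked : ∀ {x y} → Linked x y → Linked y x
    flip-linked {x} {y} (inj₁ xy)                    = inj₁ (trans (sym-G y x) xy)
    flip-linked         (inj₂ (inj₁ (x≡a , y≡b))) = inj₂ (inj₂ (y≡b , x≡a))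
    flip-linked         (inj₂ (inj₂ (x≡b , y≡a))) = inj₂ (inj₁ (y≡a , x≡b))

  addEdge-⊑ : ∀ {G′} → IsSymmetric G′ → G ⊑ G′ → G′ a b ≡ true → addEdge ⊑ G′
  addEdge-⊑ {G′} sym-G′ G⊑G′ ab x y xy with addEdge-linked xy
  ... | inj₁ xy′                  = G⊑G′ x y xy′
  ... | inj₂ (inj₁ (refl , refl)) = ab
  ... | inj₂ (inj₂ (refl , refl)) = trans (sym-G′ x y) ab

  Touches : Fin N → Set
  Touches x = Connected G x a ⊎ Connected G x b

  touches? : ∀ x → Dec (Touches x)
  touches? x = connected? G x a ⊎-dec connected? G x b

  touches-trans : ∀ {x y} → Connected G x y → Touches y → Touches x
  touches-trans xy (inj₁ ya) = inj₁ (connected-trans xy ya)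
  touches-trans xy (inj₂ yb) = inj₂ (connected-trans xy yb)

module _ {N : ℕ} {G : Graph N} (sym-G : IsSymmetric G) {a b : Fin N} where

  private
    G⁺ : Graph N
    G⁺ = addEdge G a b

  connected-addEdge : ∀ {x y} → Connected G⁺ x y → Connected G x y ⊎ (Touches G a b x × Touches G a b y)
  connected-addEdge = walk N
    where
    step : ∀ {x y z} → Connected G x y ⊎ (Touches G a b x × Touches G a b y) → Linked G a b y z →
           Connected G x z ⊎ (Touches G a b x × Touches G a b z)
    step (inj₁ xy)        (inj₁ yz) = inj₁ (connected-trans xy (connected-edge yz))
    step (inj₂ (tx , ty)) (inj₁ yz) = inj₂ (tx , touches-trans G a b (connected-sym sym-G (connected-edge yz)) ty)
    step s (inj₂ (inj₁ (refl , refl))) = inj₂ ([ inj₁ , proj₁ ] s , inj₂ (connected-refl b))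
    step s (inj₂ (inj₂ (refl , refl))) = inj₂ ([ inj₂ , proj₁ ] s , inj₁ (connected-refl a))

    walk : ∀ d {x y} → Reach G⁺ d x y → Connected G x y ⊎ (Touches G a b x × Touches G a b y)
    walk zero    refl                = inj₁ (connected-refl _)
    walk (suc d) (inj₁ r)            = walk d r
    walk (suc d) (inj₂ (z , r , zy)) = step (walk d r) (addEdge-linked G a b zy)

  touches-connected : Connected G a b → ∀ {x y} → Touches G a b x → Touches G a b y → Connected G x y
  touches-connected ab (inj₁ xa) (inj₁ ya) = connected-trans xa (connected-sym sym-G ya)
  touches-connected ab (inj₁ xa) (inj₂ yb) = connected-trans xa (connected-trans ab (connected-sym sym-G yb))
  touches-connected ab (inj₂ xb) (inj₁ ya) =
    connected-trans xb (connected-trans (connected-sym sym-G ab) (connected-sym sym-G ya))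
  touches-connected ab (inj₂ xb) (inj₂ yb) = connected-trans xb (connected-sym sym-G yb)

  private
    module Merge (¬ab : ¬ Connected G a b) {α β} (αa : Connected G α a) (leader-α : IsLeader G α)
                 (βb : Connected G β b) (leader-β : IsLeader G β) where

      T : Fin N → Set
      T = Touches G a b

      G⊑G⁺ : G ⊑ G⁺
      G⊑G⁺ = ⊑-addEdge G a b

      sym-G⁺ : IsSymmetric G⁺
      sym-G⁺ = addEdge-sym G a b sym-G

      dα dβ : ℕ
      dα = diameter G α
      dβ = diameter G β

      α≢β : α ≢ β
      α≢β refl = ¬ab (connected-trans (connected-sym sym-G αa) βb)

      within-α : ∀ {x y} → Connected G x a → Connected G y a → Reach G⁺ dα x y
      within-α xa ya = reach-⊑ G⊑G⁺ dα (diameter-sound sym-G α _ _ (into xa) (into ya))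
        where
        into : ∀ {x} → Connected G x a → Connected G α x
        into xa = connected-trans αa (connected-sym sym-G xa)

      within-β : ∀ {x y} → Connected G x b → Connected G y b → Reach G⁺ dβ x y
      within-β xb yb = reach-⊑ G⊑G⁺ dβ (diameter-sound sym-G β _ _ (into xb) (into yb))
        where
        into : ∀ {x} → Connected G x b → Connected G β x
        into xb = connected-trans βb (connected-sym sym-G xb)

      -- A walk inside one old component, the new edge, and a walk inside the other.
      joined : ∀ {x y} → T x → T y → Reach G⁺ (dα + suc dβ) x y
      joined (inj₁ xa) (inj₁ ya) = reach-≤ (m≤m+n dα _) (within-α xa ya)
      joined (inj₂ xb) (inj₂ yb) = reach-≤ (≤-trans (n≤1+n dβ) (m≤n+m _ dα)) (within-β xb yb)
      joined (inj₁ xa) (inj₂ yb) =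
        reach-+ dα (suc dβ) (within-α xa (connected-refl a))
          (reach-+ {G = G⁺} 1 dβ (reach-edge {G = G⁺} (addEdge-new G a b)) (within-β (connected-refl b) yb))
      joined (inj₂ xb) (inj₁ ya) = reach-≤ (≤-reflexive (+-comm-suc dβ dα))
        (reach-+ dβ (suc dα) (within-β xb (connected-refl b))
          (reach-+ {G = G⁺} 1 dα (reach-edge {G = G⁺} (trans (sym-G⁺ b a) (addEdge-new G a b)))
            (within-α (connected-refl a) ya)))
        where
        +-comm-suc : ∀ m n → m + suc n ≡ n + suc m
        +-comm-suc m n = trans (+-suc m n) (trans (cong suc (+-comm m n)) (sym (+-suc n m)))

      touches-spread : ∀ {v x} → T v → Connected G⁺ v x → T x
      touches-spread tv vx with connected-addEdge vx
      ... | inj₁ vx′      = touches-trans G a b (connected-sym sym-G vx′) tv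
      ... | inj₂ (_ , tx) = tx

      weight-touching : ∀ {v} → T v → weight G⁺ v ≤ 2 + (dα + suc dβ)
      weight-touching {v} tv = ≤-trans (weight-≤ G⁺ v) (+-monoʳ-≤ 2 (diameter-minimal G⁺ v
        λ x y vx vy → joined (touches-spread tv vx) (touches-spread tv vy)))

      leader-touching : ∀ {v} → IsLeader G⁺ v → T v → v ≡ α ⊎ v ≡ β
      leader-touching {v} leader⁺ (inj₁ va) = inj₁ (Fin.≤-antisym
        (leader⁺ α (reach-⊑ G⊑G⁺ N (connected-trans αa (connected-sym sym-G va))))
        (leader-α v (connected-trans va (connected-sym sym-G αa))))
      leader-touching {v} leader⁺ (inj₂ vb) = inj₂ (Fin.≤-antisym
        (leader⁺ β (reach-⊑ G⊑G⁺ N (connected-trans βb (connected-sym sym-G vb))))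
        (leader-β v (connected-trans vb (connected-sym sym-G βb))))

      others : ∀ v → v ≢ α → v ≢ β → weight G⁺ v ≤ weight G v
      others v v≢α v≢β with touches? G a b v
      ... | yes tv = ≤-trans (≤-reflexive (weight-nonleader G⁺ λ leader⁺ → [ v≢α , v≢β ] (leader-touching leader⁺ tv)))
                             z≤n
      ... | no ¬tv = weight-⊑ sym-G G⊑G⁺ v λ vx →
                       [ (λ vx′ → vx′) , (λ t → contradiction (proj₁ t) ¬tv) ] (connected-addEdge vx)

      pair : weight G⁺ α + weight G⁺ β < weight G α + weight G β
      pair = begin-strict
        weight G⁺ α + weight G⁺ β         ≤⟨ one-leader (isLeader? G⁺ α) ⟩
        2 + (dα + suc dβ)                 <⟨ +-monoʳ-< 2 (+-monoʳ-< dα (n<1+n _)) ⟩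
        (2 + dα) + (2 + dβ)               ≡⟨ cong₂ _+_ (weight-leader G leader-α) (weight-leader G leader-β) ⟨
        weight G α + weight G β           ∎
        where
        open ≤-Reasoning
        tα : T α
        tα = inj₁ αa
        tβ : T β
        tβ = inj₂ βb
        one-leader : Dec (IsLeader G⁺ α) → weight G⁺ α + weight G⁺ β ≤ 2 + (dα + suc dβ)
        one-leader (no ¬leader⁺) = begin
          weight G⁺ α + weight G⁺ β   ≡⟨ cong (_+ weight G⁺ β) (weight-nonleader G⁺ ¬leader⁺) ⟩
          weight G⁺ β                 ≤⟨ weight-touching tβ ⟩
          2 + (dα + suc dβ)           ∎
        one-leader (yes leader⁺) = begin
          weight G⁺ α + weight G⁺ β   ≡⟨ cong (weight G⁺ α +_) (weight-nonleader G⁺ ¬leader⁺β) ⟩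
          weight G⁺ α + 0             ≡⟨ +-identityʳ _ ⟩
          weight G⁺ α                 ≤⟨ weight-touching tα ⟩
          2 + (dα + suc dβ)           ∎
          where
          ¬leader⁺β : ¬ IsLeader G⁺ β
          ¬leader⁺β leader⁺β = α≢β (leader-unique sym-G⁺ leader⁺ leader⁺β (reach-saturates _ (joined tα tβ)))

      potential-drops : potential G⁺ < potential G
      potential-drops = sum-mono-<₂ α≢β others pair

  potential-merge : ¬ Connected G a b → potential G⁺ < potential G
  potential-merge ¬ab with leader-of sym-G a | leader-of sym-G b
  ... | α , αa , leader-α | β , βb , leader-β = Merge.potential-drops ¬ab αa leader-α βb leader-β

module _ {N : ℕ} where

  record Descends (G G′ : Graph N) : Set where
    field
      potential-≤        : potential G′ ≤ potential G
      strict-or-unmerged : potential G′ < potential G ⊎ Unmerged G G′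

  open Descends public

  descends-strict : ∀ {G G′} → potential G′ < potential G → Descends G G′
  descends-strict Φ′<Φ = record { potential-≤ = <⇒≤ Φ′<Φ ; strict-or-unmerged = inj₁ Φ′<Φ }

  descends-unmerged : ∀ {G G′} → IsSymmetric G → G ⊑ G′ → Unmerged G G′ → Descends G G′
  descends-unmerged sym-G G⊑G′ unmerged =
    record { potential-≤ = potential-⊑ sym-G G⊑G′ unmerged ; strict-or-unmerged = inj₂ unmerged }

  descends-trans : ∀ {G₀ G₁ G₂} → Descends G₀ G₁ → Descends G₁ G₂ → Descends G₀ G₂
  descends-trans {G₀} {G₁} {G₂} d₀₁ d₁₂ = record
    { potential-≤        = ≤-trans (potential-≤ d₁₂) (potential-≤ d₀₁)
    ; strict-or-unmerged = compose (strict-or-unmerged d₀₁) (strict-or-unmerged d₁₂)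
    }
    where
    compose : potential G₁ < potential G₀ ⊎ Unmerged G₀ G₁ →
              potential G₂ < potential G₁ ⊎ Unmerged G₁ G₂ →
              potential G₂ < potential G₀ ⊎ Unmerged G₀ G₂
    compose (inj₁ Φ₁<Φ₀) _             = inj₁ (≤-<-trans (potential-≤ d₁₂) Φ₁<Φ₀)
    compose (inj₂ _)     (inj₁ Φ₂<Φ₁) = inj₁ (<-≤-trans Φ₂<Φ₁ (potential-≤ d₀₁))
    compose (inj₂ back₀) (inj₂ back₁) = inj₂ λ xy → back₀ (back₁ xy)

  descends-addEdge : ∀ {G} → IsSymmetric G → ∀ a b → Descends G (addEdge G a b)
  descends-addEdge {G} sym-G a b with connected? G a b
  ... | no ¬ab = descends-strict (potential-merge sym-G ¬ab)
  ... | yes ab = descends-unmerged sym-G (⊑-addEdge G a b)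
    λ xy → [ (λ xy′ → xy′) , (λ t → touches-connected sym-G ab (proj₁ t) (proj₂ t)) ]
             (connected-addEdge sym-G xy)

  -- Insert the edges of G′ one pair at a time.
  ⊑⇒descends : ∀ {G G′} → IsSymmetric G → IsSymmetric G′ → G ⊑ G′ → Descends G G′
  ⊑⇒descends {G} {G′} sym-G sym-G′ G⊑G′ =
    insert (cartesianProduct (allFin N) (allFin N)) sym-G G⊑G′
      λ x y _ → inj₂ (∈-cartesianProduct⁺ (∈-allFin x) (∈-allFin y))
    where
    insert : ∀ ps {H} → IsSymmetric H → H ⊑ G′ →
             (∀ x y → G′ x y ≡ true → H x y ≡ true ⊎ (x , y) List.∈ ps) → Descends H G′
    insert [] sym-H H⊑G′ covered =
      descends-unmerged sym-H H⊑G′ (reach-⊑ (λ x y xy → [ (λ Hxy → Hxy) , (λ ()) ] (covered x y xy)) N)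
    insert ((a , b) ∷ ps) {H} sym-H H⊑G′ covered with G′ a b Bool.≟ true
    ... | yes ab = descends-trans (descends-addEdge sym-H a b)
                     (insert ps (addEdge-sym H a b sym-H) (addEdge-⊑ H a b sym-G′ H⊑G′ ab) covered′)
      where
      covered′ : ∀ x y → G′ x y ≡ true → addEdge H a b x y ≡ true ⊎ (x , y) List.∈ ps
      covered′ x y xy with covered x y xy
      ... | inj₁ Hxy         = inj₁ (⊑-addEdge H a b x y Hxy)
      ... | inj₂ (Any.here refl) = inj₁ (addEdge-new H a b)
      ... | inj₂ (Any.there xy∈) = inj₂ xy∈
    ... | no ¬ab = insert ps sym-H H⊑G′ covered′
      where
      covered′ : ∀ x y → G′ x y ≡ true → H x y ≡ true ⊎ (x , y) List.∈ ps
      covered′ x y xy with covered x y xy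
      ... | inj₁ Hxy         = inj₁ Hxy
      ... | inj₂ (Any.here refl) = contradiction xy ¬ab
      ... | inj₂ (Any.there xy∈) = inj₂ xy∈

-- Triangle completion

module _ {N : ℕ} (H : PGraph N) (independent : LowerIndependent H) where

  upper-if-lower-neighbour : ∀ {x z} → Adj H x z → z ∈ lower H → x ∈ upper H
  upper-if-lower-neighbour {x} {z} xz z∈ℓ with edge-vert H x z xz
  ... | inj₂ x∈u = x∈u
  ... | inj₁ x∈ℓ = contradiction (trans (sym xz) (independent x z x∈ℓ z∈ℓ)) λ ()

  path₂-triEdge : ∀ {x y z} → x ≢ y → ¬ (x ∈ lower H × y ∈ lower H) → Adj H x z → Adj H z y → TriEdge H x y
  path₂-triEdge {x} {y} {z} x≢y ¬ℓℓ xz zy with edge-vert H z y zy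
  ... | inj₁ z∈ℓ =
    inj₂ (inj₁ (upper-if-lower-neighbour xz z∈ℓ , upper-if-lower-neighbour yz z∈ℓ , x≢y , z , xz , zy))
    where
    yz : Adj H y z
    yz = trans (edge-sym H y z) zy
  ... | inj₂ z∈u with edge-vert H x z xz | edge-vert H y z (trans (edge-sym H y z) zy)
  ...   | inj₂ x∈u | inj₂ y∈u = inj₂ (inj₁ (x∈u , y∈u , x≢y , z , xz , zy))
  ...   | inj₂ x∈u | inj₁ y∈ℓ = inj₂ (inj₂ (inj₁ (x∈u , y∈ℓ , z , z∈u , xz , zy)))
  ...   | inj₁ x∈ℓ | inj₂ y∈u = inj₂ (inj₂ (inj₂ (x∈ℓ , y∈u , z , z∈u , xz , zy)))
  ...   | inj₁ x∈ℓ | inj₁ y∈ℓ = contradiction (x∈ℓ , y∈ℓ) ¬ℓℓ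

  reach₂-triEdge : ∀ {x y} → Reach (edge H) 2 x y → x ≢ y → ¬ (x ∈ lower H × y ∈ lower H) → TriEdge H x y
  reach₂-triEdge (inj₁ (inj₁ x≡y))                   x≢y ¬ℓℓ = contradiction x≡y x≢y
  reach₂-triEdge (inj₁ (inj₂ (_ , refl , xy)))       x≢y ¬ℓℓ = inj₁ xy
  reach₂-triEdge (inj₂ (_ , inj₁ refl , xy))         x≢y ¬ℓℓ = inj₁ xy
  reach₂-triEdge (inj₂ (_ , inj₂ (_ , refl , xz) , zy)) x≢y ¬ℓℓ = path₂-triEdge x≢y ¬ℓℓ xz zy

  module _ (H′ : PGraph N) (tri : TriSubgraph H H′) where

    private
      lift : ∀ d {x y} → Reach (edge H) d x y → Reach (edge H′) d x y
      lift = reach-⊑ λ x y xy → proj₂ tri x y (inj₁ xy)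

      shortcut : ∀ {x y z} → x ≢ y → ¬ (x ∈ lower H × y ∈ lower H) → Adj H x z → Adj H z y → Adj H′ x y
      shortcut x≢y ¬ℓℓ xz zy = proj₂ tri _ _ (path₂-triEdge x≢y ¬ℓℓ xz zy)

    -- Of the last three steps w – z₁ – z – y, either z₁ – z – y or w – z₁ – z has ends not both lower.
    triangle-shortcut : ∀ d {x y} → Reach (edge H) (3 + d) x y → Reach (edge H′) (2 + d) x y
    triangle-shortcut d (inj₁ r) = lift (2 + d) r
    triangle-shortcut d (inj₂ (z , inj₁ r , zy)) = lift (2 + d) (inj₂ (z , r , zy))
    triangle-shortcut d (inj₂ (z , inj₂ (z₁ , inj₁ r , z₁z) , zy)) =
      lift (2 + d) (inj₂ (z , inj₂ (z₁ , r , z₁z) , zy))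
    triangle-shortcut d {y = y} (inj₂ (z , inj₂ (z₁ , inj₂ (w , r , wz₁) , z₁z) , zy))
      with (z₁ ∈? lower H) ×-dec (y ∈? lower H)
    ... | yes (z₁∈ℓ , y∈ℓ) with w F.≟ z
    ...   | yes refl = lift (2 + d) (inj₁ (inj₂ (w , r , zy)))
    ...   | no w≢z   = inj₂ (z , inj₂ (w , lift d r , shortcut w≢z ¬ℓℓ wz₁ z₁z) , proj₂ tri z y (inj₁ zy))
      where
      ¬ℓℓ : ¬ (w ∈ lower H × z ∈ lower H)
      ¬ℓℓ (_ , z∈ℓ) = contradiction (trans (sym z₁z) (independent z₁ z z₁∈ℓ z∈ℓ)) λ ()
    triangle-shortcut d {y = y} (inj₂ (z , inj₂ (z₁ , inj₂ (w , r , wz₁) , z₁z) , zy))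
        | no ¬ℓℓ with z₁ F.≟ y
    ...   | yes refl  = lift (2 + d) (inj₁ (inj₂ (w , r , wz₁)))
    ...   | no z₁≢y   =
      inj₂ (z₁ , inj₂ (w , lift d r , proj₂ tri w z₁ (inj₁ wz₁)) , shortcut z₁≢y ¬ℓℓ z₁z zy)

∣p∪q∣≤∣p∣+∣q∣ : ∀ {n} (p q : Subset n) → ∣ p ∪ q ∣ ≤ ∣ p ∣ + ∣ q ∣
∣p∪q∣≤∣p∣+∣q∣ []            []            = z≤n
∣p∪q∣≤∣p∣+∣q∣ (outside ∷ p) (outside ∷ q) = ∣p∪q∣≤∣p∣+∣q∣ p q
∣p∪q∣≤∣p∣+∣q∣ (outside ∷ p) (inside  ∷ q) =
  ≤-trans (s≤s (∣p∪q∣≤∣p∣+∣q∣ p q)) (≤-reflexive (sym (+-suc ∣ p ∣ ∣ q ∣)))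
∣p∪q∣≤∣p∣+∣q∣ (inside  ∷ p) (outside ∷ q) = s≤s (∣p∪q∣≤∣p∣+∣q∣ p q)
∣p∪q∣≤∣p∣+∣q∣ (inside  ∷ p) (inside  ∷ q) =
  s≤s (≤-trans (∣p∪q∣≤∣p∣+∣q∣ p q) (+-monoʳ-≤ ∣ p ∣ (n≤1+n ∣ q ∣)))

module _ {N : ℕ} where

  vertices : PGraph N → Subset N
  vertices H = lower H ∪ upper H

  order : PGraph N → ℕ
  order H = ∣ vertices H ∣

  order-≤ : ∀ {m} (H : PGraph N) → ∣ lower H ∣ ≡ ∣ upper H ∣ → ∣ upper H ∣ ≤ m → order H ≤ m + m
  order-≤ H ∣ℓ∣≡∣u∣ ∣u∣≤m = ≤-trans (∣p∪q∣≤∣p∣+∣q∣ (lower H) (upper H))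
    (+-mono-≤ (≤-trans (≤-reflexive ∣ℓ∣≡∣u∣) ∣u∣≤m) ∣u∣≤m)

  vertices-⊆ : ∀ {H H′} → (∀ v → InV H v → InV H′ v) → vertices H ⊆ vertices H′
  vertices-⊆ {H} {H′} V⊆V′ {v} = x∈p∪q⁺ ∘ V⊆V′ v ∘ x∈p∪q⁻ (lower H) (upper H)

  order-mono : ∀ {H H′} → (∀ v → InV H v → InV H′ v) → order H ≤ order H′
  order-mono {H} {H′} V⊆V′ = p⊆q⇒∣p∣≤∣q∣ (vertices-⊆ {H} {H′} V⊆V′)

  order-mono-< : ∀ {H H′} → (∀ v → InV H v → InV H′ v) → ∀ {v} → InV H′ v → ¬ InV H v → order H < order H′
  order-mono-< {H} {H′} V⊆V′ v∈V′ v∉V =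
    p⊂q⇒∣p∣<∣q∣ (vertices-⊆ {H} {H′} V⊆V′ , _ , x∈p∪q⁺ v∈V′ , v∉V ∘ x∈p∪q⁻ (lower H) (upper H))

  edgeless : Graph N
  edgeless _ _ = false

  potential-edgeless : potential edgeless ≤ N * 2
  potential-edgeless = sum-≤-* 2 λ v → ≤-trans (weight-≤ edgeless v)
    (+-monoʳ-≤ 2 (diameter-minimal edgeless v λ x y vx vy →
      trans (reach-isolated (λ _ → refl) N vx) (sym (reach-isolated (λ _ → refl) N vy))))

  potential-order : ∀ (H : PGraph N) → N * 2 ≤ potential (edge H) + order H * 2
  potential-order H = begin
    N * 2                                   ≡⟨ cong (_* 2) (sym ∣∁V∣+∣V∣≡N) ⟩
    (∣ ∁ (vertices H) ∣ + order H) * 2      ≡⟨ *-distribʳ-+ 2 ∣ ∁ (vertices H) ∣ (order H) ⟩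
    ∣ ∁ (vertices H) ∣ * 2 + order H * 2    ≤⟨ +-monoˡ-≤ _ (∣p∣*c≤sum (∁ (vertices H)) 2 outside-weight) ⟩
    potential (edge H) + order H * 2        ∎
    where
    open ≤-Reasoning
    ∣∁V∣+∣V∣≡N : ∣ ∁ (vertices H) ∣ + order H ≡ N
    ∣∁V∣+∣V∣≡N = trans (cong (_+ order H) (∣∁p∣≡n∸∣p∣ (vertices H))) (m∸n+n≡m (∣p∣≤n (vertices H)))
    outside-weight : ∀ v → v ∈ ∁ (vertices H) → 2 ≤ weight (edge H) v
    outside-weight v v∈∁V = ≤-trans (m≤m+n 2 _) (≤-reflexive (sym (weight-leader (edge H) leader)))
      where
      isolated : ∀ z → edge H v z ≡ false
      isolated z with edge H v z in vz
      ... | false = refl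
      ... | true  = contradiction (x∈p∪q⁺ (edge-vert H v z vz)) (x∈∁p⇒x∉p v∈∁V)
      leader : IsLeader (edge H) v
      leader u uv = ≤-reflexive (cong _ (sym (reach-isolated isolated N (connected-sym (edge-sym H) uv))))

private
  ≡-from-true⇔ : ∀ {a b : Bool} → (a ≡ true → b ≡ true) → (b ≡ true → a ≡ true) → a ≡ b
  ≡-from-true⇔ {false} {false} _   _   = refl
  ≡-from-true⇔ {false} {true}  _   b⇒a = b⇒a refl
  ≡-from-true⇔ {true}  {false} a⇒b _   = sym (a⇒b refl)
  ≡-from-true⇔ {true}  {true}  _   _   = refl

module _ {N : ℕ} where

  Admissible : ℕ → PGraph N → Set
  Admissible m H = ∣ lower H ∣ ≡ ∣ upper H ∣ × ∣ upper H ∣ ≤ m × LowerIndependent H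

  Extension : PGraph N → PGraph N → Set
  Extension H H′ = lower H ⊆ lower H′ × upper H ⊆ upper H′ × TriSubgraph H H′

  ProperExtension : PGraph N → PGraph N → Set
  ProperExtension H H′ = lower H ⊆ lower H′ × upper H ⊆ upper H′ × TriSubgraph H H′ × ¬ SameGraph H H′

  Φ : PGraph N → ℕ
  Φ H = potential (edge H)

  inV? : ∀ (H : PGraph N) v → Dec (InV H v)
  inV? H v = (v ∈? lower H) ⊎-dec (v ∈? upper H)

  new-vertex-or-⊆ : ∀ (H H′ : PGraph N) → (∃[ v ] (InV H′ v × ¬ InV H v)) ⊎ (∀ v → InV H′ v → InV H v)
  new-vertex-or-⊆ H H′ with Fin.any? (λ v → inV? H′ v ×-dec ¬? (inV? H v))
  ... | yes new = inj₁ new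
  ... | no ¬new = inj₂ λ v v∈V′ → decidable-stable (inV? H v) λ v∉V → ¬new (v , v∈V′ , v∉V)

  triSubgraph-⊑ : ∀ (H H′ : PGraph N) → TriSubgraph H H′ → edge H ⊑ edge H′
  triSubgraph-⊑ H H′ tri x y xy = proj₂ tri x y (inj₁ xy)

  stagnation : ∀ {H₀ H₁ H₂ : PGraph N} → LowerIndependent H₀ → LowerIndependent H₂ →
               Extension H₀ H₁ → Extension H₁ H₂ →
               Unmerged (edge H₀) (edge H₁) → Unmerged (edge H₁) (edge H₂) → (∀ v → InV H₂ v → InV H₁ v) →
               (∀ x y → Connected (edge H₀) x y → Reach (edge H₀) 2 x y) → SameGraph H₁ H₂
  stagnation {H₀} {H₁} {H₂} indep₀ indep₂ (ℓ₀⊆ℓ₁ , _ , tri₀) (ℓ₁⊆ℓ₂ , u₁⊆u₂ , tri₁)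
             unmerged₀₁ unmerged₁₂ V₂⊆V₁ close₀ =
    (λ v → ℓ₁⊆ℓ₂ , lower-back v) , (λ v → u₁⊆u₂ , upper-back v) ,
    λ x y → ≡-from-true⇔ (triSubgraph-⊑ H₁ H₂ tri₁ x y) (edge-back x y)
    where
    lower-back : ∀ v → v ∈ lower H₂ → v ∈ lower H₁
    lower-back v v∈ℓ₂ with V₂⊆V₁ v (inj₁ v∈ℓ₂)
    ... | inj₁ v∈ℓ₁ = v∈ℓ₁
    ... | inj₂ v∈u₁ = contradiction (v∈ℓ₂ , u₁⊆u₂ v∈u₁) (disjoint H₂ v)
    upper-back : ∀ v → v ∈ upper H₂ → v ∈ upper H₁
    upper-back v v∈u₂ with V₂⊆V₁ v (inj₂ v∈u₂)
    ... | inj₁ v∈ℓ₁ = contradiction (ℓ₁⊆ℓ₂ v∈ℓ₁ , v∈u₂) (disjoint H₂ v)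
    ... | inj₂ v∈u₁ = v∈u₁
    edge-back : ∀ x y → Adj H₂ x y → Adj H₁ x y
    edge-back x y xy = proj₂ tri₀ x y (reach₂-triEdge H₀ indep₀ (close₀ x y near) x≢y ¬ℓℓ)
      where
      near : Connected (edge H₀) x y
      near = unmerged₀₁ (unmerged₁₂ (connected-edge {G = edge H₂} xy))
      x≢y : x ≢ y
      x≢y refl = contradiction (trans (sym xy) (edge-irrefl H₂ x)) λ ()
      ¬ℓℓ : ¬ (x ∈ lower H₀ × y ∈ lower H₀)
      ¬ℓℓ (x∈ℓ , y∈ℓ) =
        contradiction (trans (sym xy) (indep₂ x y (ℓ₁⊆ℓ₂ (ℓ₀⊆ℓ₁ x∈ℓ)) (ℓ₁⊆ℓ₂ (ℓ₀⊆ℓ₁ y∈ℓ)))) λ ()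

  two-step-drop : ∀ {H₀ H₁ H₂ : PGraph N} → LowerIndependent H₀ → LowerIndependent H₂ →
                  ProperExtension H₀ H₁ → ProperExtension H₁ H₂ → Φ H₂ + order H₀ < Φ H₀ + order H₂
  two-step-drop {H₀} {H₁} {H₂} indep₀ indep₂ (ℓ₀⊆ℓ₁ , u₀⊆u₁ , tri₀ , _) (ℓ₁⊆ℓ₂ , u₁⊆u₂ , tri₁ , H₁≢H₂)
    =
    [ (λ Φ₂<Φ₀ → +-mono-<-≤ Φ₂<Φ₀ n₀≤n₂) , +-mono-≤-< Φ₂≤Φ₀ ] progress
    where
    d₀₁ : Descends (edge H₀) (edge H₁)
    d₀₁ = ⊑⇒descends (edge-sym H₀) (edge-sym H₁) (triSubgraph-⊑ H₀ H₁ tri₀)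
    d₁₂ : Descends (edge H₁) (edge H₂)
    d₁₂ = ⊑⇒descends (edge-sym H₁) (edge-sym H₂) (triSubgraph-⊑ H₁ H₂ tri₁)
    Φ₂≤Φ₀ : Φ H₂ ≤ Φ H₀
    Φ₂≤Φ₀ = ≤-trans (potential-≤ d₁₂) (potential-≤ d₀₁)
    n₀≤n₁ : order H₀ ≤ order H₁
    n₀≤n₁ = order-mono {H = H₀} {H₁} (proj₁ tri₀)
    n₀≤n₂ : order H₀ ≤ order H₂
    n₀≤n₂ = ≤-trans n₀≤n₁ (order-mono {H = H₁} {H₂} (proj₁ tri₁))
    progress : Φ H₂ < Φ H₀ ⊎ order H₀ < order H₂
    progress with strict-or-unmerged d₀₁ | strict-or-unmerged d₁₂
    ... | inj₁ Φ₁<Φ₀ | _ = inj₁ (≤-<-trans (potential-≤ d₁₂) Φ₁<Φ₀)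
    ... | inj₂ _ | inj₁ Φ₂<Φ₁ = inj₁ (<-≤-trans Φ₂<Φ₁ (potential-≤ d₀₁))
    ... | inj₂ unmerged₀₁ | inj₂ unmerged₁₂ with new-vertex-or-⊆ H₁ H₂ | far-or-close (edge H₀)
    ...   | inj₁ (v , v∈V₂ , v∉V₁) | _ =
              inj₂ (≤-<-trans n₀≤n₁ (order-mono-< {H = H₁} {H₂} (proj₁ tri₁) v∈V₂ v∉V₁))
    ...   | inj₂ _ | inj₁ (x , y , xy , far) = inj₁ (≤-<-trans (potential-≤ d₁₂)
              (potential-shortcut (edge-sym H₀) (triSubgraph-⊑ H₀ H₁ tri₀) unmerged₀₁
                (triangle-shortcut H₀ indep₀ H₁ tri₀) xy far))
    ...   | inj₂ V₂⊆V₁ | inj₂ close = contradiction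
              (stagnation {H₀ = H₀} {H₁} {H₂} indep₀ indep₂
                (ℓ₀⊆ℓ₁ , u₀⊆u₁ , tri₀) (ℓ₁⊆ℓ₂ , u₁⊆u₂ , tri₁) unmerged₀₁ unmerged₁₂ V₂⊆V₁ close)
              H₁≢H₂

-- The length bound

telescope : ∀ (f g : ℕ → ℕ) j → (∀ t → t < j → f (suc t) + g t < f t + g (suc t)) →
            f j + g 0 + j ≤ f 0 + g j
telescope f g zero    step = ≤-reflexive (+-identityʳ _)
telescope f g (suc j) step = +-cancelʳ-≤ (f j + g j) _ _ (begin
  f (suc j) + g 0 + suc j + (f j + g j)    ≡⟨ regroup (f (suc j)) (g 0) j (f j) (g j) ⟩
  suc (f (suc j) + g j) + (f j + g 0 + j)  ≤⟨ +-mono-≤ (step j (n<1+n j)) (telescope f g j (λ t → step t ∘ m<n⇒m<1+n)) ⟩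
  f j + g (suc j) + (f 0 + g j)            ≡⟨ regroup′ (f j) (g (suc j)) (f 0) (g j) ⟩
  f 0 + g (suc j) + (f j + g j)            ∎)
  where
  open ≤-Reasoning
  regroup : ∀ a b c d e → a + b + suc c + (d + e) ≡ suc (a + e) + (d + b + c)
  regroup = solve-∀
  regroup′ : ∀ a b c d → a + b + (c + d) ≡ c + b + (a + d)
  regroup′ = solve-∀

odd : ℕ → ℕ
odd zero    = 1
odd (suc t) = suc (suc (odd t))

1≤odd : ∀ t → 1 ≤ odd t
1≤odd zero    = s≤s z≤n
1≤odd (suc t) = s≤s z≤n

odd-mono-≤ : ∀ {s t} → s ≤ t → odd s ≤ odd t
odd-mono-≤ {t = t} z≤n = 1≤odd t
odd-mono-≤ (s≤s s≤t)   = s≤s (s≤s (odd-mono-≤ s≤t))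

odd≡ : ∀ t → odd t ≡ suc (t + t)
odd≡ zero    = refl
odd≡ (suc t) = cong (2 +_) (trans (odd≡ t) (sym (+-suc t t)))

odd-cover : ∀ k → 1 ≤ k → ∃[ j ] (odd j ≤ k × k ≤ suc (odd j))
odd-cover (suc zero)          _ = 0 , ≤-refl , n≤1+n 1
odd-cover (suc (suc zero))    _ = 0 , s≤s z≤n , ≤-refl
odd-cover (suc (suc (suc k))) _ with odd-cover (suc k) (s≤s z≤n)
... | j , lo , hi = suc j , s≤s (s≤s lo) , s≤s (s≤s hi)

module _ {N m k : ℕ} (H : ℕ → PGraph N)
         (admissible : ∀ i → 1 ≤ i → i ≤ k → Admissible m (H i))
         (extends : ∀ i → 1 ≤ i → i < k → ProperExtension (H i) (H (suc i))) where

  private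
    independent : ∀ i → 1 ≤ i → i ≤ k → LowerIndependent (H i)
    independent i 1≤i i≤k = proj₂ (proj₂ (admissible i 1≤i i≤k))

    drop : ∀ i → 1 ≤ i → 2 + i ≤ k → Φ (H (2 + i)) + order (H i) < Φ (H i) + order (H (2 + i))
    drop i 1≤i 2+i≤k = two-step-drop {H₀ = H i} {H (1 + i)} {H (2 + i)}
      (independent i 1≤i (≤-trans (m≤n+m i 2) 2+i≤k)) (independent (2 + i) (s≤s z≤n) 2+i≤k)
      (extends i 1≤i (≤-trans (n≤1+n _) 2+i≤k)) (extends (suc i) (s≤s z≤n) 2+i≤k)

    accumulated : ∀ j → odd j ≤ k → Φ (H (odd j)) + order (H 1) + j ≤ Φ (H 1) + order (H (odd j))
    accumulated j oddj≤k = telescope (Φ ∘ H ∘ odd) (order ∘ H ∘ odd) j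
      λ t t<j → drop (odd t) (1≤odd t) (≤-trans (odd-mono-≤ t<j) oddj≤k)

    potential-first : Φ (H 1) ≤ N * 2
    potential-first =
      ≤-trans (potential-≤ (⊑⇒descends {G = edgeless} (λ _ _ → refl) (edge-sym (H 1)) λ _ _ ())) (potential-edgeless {N})

    steps-≤ : ∀ j → odd j ≤ k → j ≤ (m + m) * 3
    steps-≤ j oddj≤k = ≤-trans (+-cancelˡ-≤ (Φ (H i)) j (n * 3) (begin
      Φ (H i) + j                       ≤⟨ +-monoˡ-≤ j (m≤m+n (Φ (H i)) (order (H 1))) ⟩
      Φ (H i) + order (H 1) + j         ≤⟨ accumulated j oddj≤k ⟩
      Φ (H 1) + n                       ≤⟨ +-monoˡ-≤ n potential-first ⟩
      N * 2 + n                         ≤⟨ +-monoˡ-≤ n (potential-order (H i)) ⟩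
      Φ (H i) + n * 2 + n               ≡⟨ regroup (Φ (H i)) n ⟩
      Φ (H i) + n * 3                   ∎))
      (*-monoˡ-≤ 3 (order-≤ (H i) (proj₁ admissible-i) (proj₁ (proj₂ admissible-i))))
      where
      open ≤-Reasoning
      i n : ℕ
      i = odd j
      n = order (H i)
      admissible-i : Admissible m (H i)
      admissible-i = admissible i (1≤odd j) oddj≤k
      regroup : ∀ a b → a + b * 2 + b ≡ a + b * 3
      regroup = solve-∀

  length-bound : 1 ≤ m → k ≤ 14 * m
  length-bound 1≤m with 1 ≤? k
  ... | no  k≱1 = ≤-trans (≤-pred (≰⇒> k≱1)) z≤n
  ... | yes 1≤k with odd-cover k 1≤k
  ...   | j , oddj≤k , k≤ = begin
    k                                            ≤⟨ k≤ ⟩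
    suc (odd j)                                  ≡⟨ cong suc (odd≡ j) ⟩
    2 + (j + j)                                  ≤⟨ +-monoʳ-≤ 2 (+-mono-≤ (steps-≤ j oddj≤k) (steps-≤ j oddj≤k)) ⟩
    2 + ((m + m) * 3 + (m + m) * 3)              ≤⟨ +-monoˡ-≤ _ (*-monoʳ-≤ 2 1≤m) ⟩
    2 * m + ((m + m) * 3 + (m + m) * 3)          ≡⟨ regroup m ⟩
    14 * m                                       ∎
    where
    open ≤-Reasoning
    regroup : ∀ m → 2 * m + ((m + m) * 3 + (m + m) * 3) ≡ 14 * m
    regroup = solve-∀

lemma6 : ∃[ c ] (0 < c × (∀ (m : ℕ) → 1 ≤ m → ∀ (N k : ℕ) (H : ℕ → PGraph N)
           → (∀ i → 1 ≤ i → i ≤ k →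
                ∣ lower (H i) ∣ ≡ ∣ upper (H i) ∣ × ∣ upper (H i) ∣ ≤ m × LowerIndependent (H i))
           → (∀ i → 1 ≤ i → i < k →
                lower (H i) ⊆ lower (H (suc i)) × upper (H i) ⊆ upper (H (suc i))
                × TriSubgraph (H i) (H (suc i)) × ¬ SameGraph (H i) (H (suc i)))
           → k ≤ c * m))
lemma6 = 14 , s≤s z≤n , λ m 1≤m N k H admissible extends → length-bound H admissible extends 1≤m
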